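{- Let $p$ be an odd prime. Then $p$ is a counterexample to Kurepa's hypothesis (i.e. $p\mid\, !p$) if and only if, in the field $\mathbb F_p$, $$A\,(B_0,B_1,\ldots,B_{p-2})^{T}=(S_0,-S_1,S_2,\ldots,(-1)^{p-2}S_{p-2})^{T},$$ where $A=(a_{ij})_{1\le i,j\le p-1}$ has $a_{i1}=1$ and $a_{ij}=(p-i)^{p-j}$ for $2\le j\le p-1$; equivalently, if and only if, in $\mathbb F_p$, $$C\,(-S_0,S_1,-S_2,\ldots,(-1)^{p-1}S_{p-2})^{T}=(B_0,B_1,\ldots,B_{p-2})^{T},$$ where $C=(c_{ij})_{1\le i,j\le p-1}$ with $c_{ij}=(p-j)^{i-1}$.
   Context: The left factorial is $!n=\sum_{k=0}^{n-1}k!$. The derangement numbers are $S_k=k!\sum_{i=0}^{k}\frac{(-1)^i}{i!}$ for $k\ge 0$. The Bell numbers are defined by $B_0=1$ and $B_{n+1}=\sum_{k=0}^{n}\binom nk B_k$ for $n\ge 0$. All integers are reduced modulo $p$ in the matrix equations. -}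

module Defs where

open import Data.Nat as ℕ using (ℕ; zero; suc; _∸_; _!)
open import Data.Nat.Properties using (_!≢0)
open import Data.Nat.DivMod using (_/_)
open import Data.Nat.Combinatorics using (_C_)
open import Data.Fin using (Fin; toℕ)
open import Data.Vec as Vec using (Vec; []; _∷_; _∷ʳ_; lookup; tabulate; last)
open import Data.Integer as ℤ using (ℤ; +_; _-_)
open import Data.Integer.Divisibility as ℤD using ()

Σℕ : ℕ → (ℕ → ℕ) → ℕ
Σℕ zero    f = 0
Σℕ (suc n) f = Σℕ n f ℕ.+ f n

Σℤ : ℕ → (ℕ → ℤ) → ℤ
Σℤ zero    f = + 0
Σℤ (suc n) f = Σℤ n f ℤ.+ f n

leftFactorial : ℕ → ℕ
leftFactorial n = Σℕ n (λ k → k !)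

sgn : ℕ → ℤ
sgn i = ℤ.-[1+ 0 ] ℤ.^ i

-- derangement numbers  S_k = k! Σ_{i=0}^{k} (-1)^i / i!  =  Σ_{i=0}^{k} (-1)^i (k!/i!)
-- (k!/i! is an exact integer quotient for i ≤ k)
derangement : ℕ → ℤ
derangement k = Σℤ (suc k) (λ i → sgn i ℤ.* + (_/_ (k !) (i !) {{i !≢0}}))

bellTable : (n : ℕ) → Vec ℕ (suc n)
bellTable zero    = 1 ∷ []
bellTable (suc n) = t ∷ʳ Vec.sum (tabulate λ (k : Fin (suc n)) → (n C toℕ k) ℕ.* lookup t k)
  where t = bellTable n

-- Bell numbers: B_0 = 1, B_{n+1} = Σ_{k=0}^{n} C(n,k) B_k
bell : ℕ → ℕ
bell n = last (bellTable n)

-- congruence modulo p in ℤ  (equality in 𝔽_p of the reductions)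
_≡_[mod_] : ℤ → ℤ → ℕ → Set
x ≡ y [mod p ] = (+ p) ℤD.∣ (x - y)

matA : ℕ → ℕ → ℕ → ℤ
matA p i 1 = + 1
matA p i j = + ((p ∸ i) ℕ.^ (p ∸ j))

matC : ℕ → ℕ → ℕ → ℤ
matC p i j = + ((p ∸ j) ℕ.^ (i ∸ 1))

-- A (B_0,…,B_{p-2})^T = (S_0,-S_1,…,(-1)^{p-2} S_{p-2})^T in 𝔽_p
-- row i (1 ≤ i ≤ p-1): Σ_{j=1}^{p-1} a_ij B_{j-1} ≡ (-1)^{i-1} S_{i-1}
SystemA : ℕ → Set
SystemA p = (i : ℕ) → 1 ℕ.≤ i → i ℕ.≤ p ∸ 1 →
  Σℤ (p ∸ 1) (λ j → matA p i (suc j) ℤ.* + bell j)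
    ≡ sgn (i ∸ 1) ℤ.* derangement (i ∸ 1) [mod p ]

-- C (-S_0,S_1,…,(-1)^{p-1} S_{p-2})^T = (B_0,…,B_{p-2})^T in 𝔽_p
-- row i (1 ≤ i ≤ p-1): Σ_{j=1}^{p-1} c_ij (-1)^j S_{j-1} ≡ B_{i-1}
SystemC : ℕ → Set
SystemC p = (i : ℕ) → 1 ℕ.≤ i → i ℕ.≤ p ∸ 1 →
  Σℤ (p ∸ 1) (λ j → matC p i (suc j) ℤ.* (sgn (suc j) ℤ.* derangement j))
    ≡ + bell (i ∸ 1) [mod p ]

module Submission where

-- Write q = p − 1, D_k = (−1)ᵏ·S_k for the signed derangement numbers, and
-- M_n(a)(N) = Σ_{j≤N} C(N,j)·(N−j)ⁿ·a_j for the binomial moments of an integer sequence a.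
-- All three conditions turn out to be equivalent to the single congruence D_q ≡ 0 (mod p).
--  * Over ℤ: the moments satisfy M_{n+1}(a)(M+1) = (M+1)·Σ_k C(n,k)·M_k(a)(M); hence, by the
--    derangement and Bell recurrences, M_k(S)(N) = N!·B_k for k ≤ N, and M_N((−1)ʲ)(N) = N!.
--  * Modulo p: C(q,j) ≡ (−1)ʲ, Fermat's theorem and Wilson's theorem (read off from M_q((−1)ʲ)(q) = q!)
--    turn the first identity into the central congruence Σ_{j<p} (q−j)ⁿ·D_j ≡ −B_n for n ≤ q.
--  * Kurepa's side: !p ≡ D_q, by telescoping the recurrence D_{k+1} = 1 − (k+1)·D_k.
--  * The rows of both systems are evaluated with the central congruence; for A this needs the
--    geometric sums Σ_{j<q} x^{q−j}·yʲ, which modulo p single out y = x and y = 0.  Row i of A becomes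
--    D_{i−1} − D_q ≡ D_{i−1} and row i of C becomes B_{i−1} + 0^{i−1}·D_q ≡ B_{i−1}.

open import Defs
open import Data.Nat using (ℕ)
open import Data.Nat.Divisibility using (_∣_)
open import Relation.Binary.PropositionalEquality using (_≢_)
open import Data.Nat.Primality using (Prime)
open import Data.Product using (_×_)
open import Function.Bundles using (_⇔_)

open import Data.Nat as ℕ using (zero; suc; _<_; _≤_; z≤n; s≤s; _!; _∸_)
import Data.Nat.Properties as ℕP
open import Data.Nat.Properties using (_!≢0)
open import Data.Nat.DivMod using (_/_; *-/-assoc; n/n≡1)
import Data.Nat.Divisibility as ℕD
open import Data.Nat.Primality using (euclidsLemma; ¬prime[0]; ¬prime[1])
open import Data.Nat.Combinatorics using (_C_; nCk+nC[k+1]≡[n+1]C[k+1]; k>n⇒nCk≡0; nCk≡nC[n∸k]; nC1≡n; nCn≡1)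
import Data.Nat.Tactic.RingSolver as ℕRing
open import Data.Integer as ℤ using (ℤ; +_; 0ℤ; 1ℤ; _+_; _*_; -_; _-_; _^_)
import Data.Integer.Properties as ℤP
open import Data.Integer.Tactic.RingSolver using (solve-∀)
open import Algebra.Properties.CommutativeSemigroup ℤP.*-commutativeSemigroup using (x∙yz≈y∙xz)
open import Data.Fin using (Fin; toℕ) renaming (zero to fzero; suc to fsuc)
open import Data.Vec as Vec using (Vec; []; _∷_; _∷ʳ_; lookup; tabulate)
import Data.Vec.Properties as VecP
open import Data.Product using (∃-syntax; _,_)
open import Data.Sum using (_⊎_; inj₁; inj₂)
open import Data.Empty using (⊥-elim)
open import Relation.Nullary using (¬_; yes; no)
open import Data.Integer.Divisibility.Signed as ℤD using (divides; ∣ᵤ⇒∣; ∣⇒∣ᵤ)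
open import Relation.Binary.Bundles using (Setoid)
open import Function.Bundles using (mk⇔)
import Function.Properties.Equivalence as ⇔
open import Relation.Binary.PropositionalEquality using (_≡_; refl; sym; trans; cong; cong₂; subst; module ≡-Reasoning)

Σ-cong : ∀ n {f g : ℕ → ℤ} → (∀ i → i < n → f i ≡ g i) → Σℤ n f ≡ Σℤ n g
Σ-cong zero    eq = refl
Σ-cong (suc n) eq = cong₂ _+_ (Σ-cong n (λ i i<n → eq i (ℕP.m<n⇒m<1+n i<n))) (eq n ℕP.≤-refl)

Σ-zero : ∀ n {f : ℕ → ℤ} → (∀ i → i < n → f i ≡ 0ℤ) → Σℤ n f ≡ 0ℤ
Σ-zero zero    eq = refl
Σ-zero (suc n) eq = cong₂ _+_ (Σ-zero n (λ i i<n → eq i (ℕP.m<n⇒m<1+n i<n))) (eq n ℕP.≤-refl)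

Σ-+ : ∀ n (f g : ℕ → ℤ) → Σℤ n (λ i → f i + g i) ≡ Σℤ n f + Σℤ n g
Σ-+ zero    f g = refl
Σ-+ (suc n) f g = trans (cong (_+ (f n + g n)) (Σ-+ n f g)) (interchange (Σℤ n f) (Σℤ n g) (f n) (g n))
  where
  interchange : ∀ a b c d → a + b + (c + d) ≡ a + c + (b + d)
  interchange = solve-∀

Σ-*ˡ : ∀ n c (f : ℕ → ℤ) → c * Σℤ n f ≡ Σℤ n (λ i → c * f i)
Σ-*ˡ zero    c f = ℤP.*-zeroʳ c
Σ-*ˡ (suc n) c f = trans (ℤP.*-distribˡ-+ c (Σℤ n f) (f n)) (cong (_+ c * f n) (Σ-*ˡ n c f))

Σ-*ʳ : ∀ n c (f : ℕ → ℤ) → Σℤ n f * c ≡ Σℤ n (λ i → f i * c)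
Σ-*ʳ n c f = trans (ℤP.*-comm (Σℤ n f) c) (trans (Σ-*ˡ n c f) (Σ-cong n (λ i _ → ℤP.*-comm c (f i))))

Σ-neg : ∀ n (f : ℕ → ℤ) → - Σℤ n f ≡ Σℤ n (λ i → - f i)
Σ-neg zero    f = refl
Σ-neg (suc n) f = trans (ℤP.neg-distrib-+ (Σℤ n f) (f n)) (cong (_+ - f n) (Σ-neg n f))

Σ-const : ∀ n c → Σℤ n (λ _ → c) ≡ + n * c
Σ-const zero    c = sym (ℤP.*-zeroˡ c)
Σ-const (suc n) c = begin
  Σℤ n (λ _ → c) + c  ≡⟨ cong (_+ c) (Σ-const n c) ⟩
  + n * c + c         ≡⟨ cong (_+_ (+ n * c)) (sym (ℤP.*-identityˡ c)) ⟩
  + n * c + 1ℤ * c    ≡⟨ sym (ℤP.*-distribʳ-+ c (+ n) 1ℤ) ⟩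
  (+ n + 1ℤ) * c      ≡⟨ cong (_* c) (trans (sym (ℤP.pos-+ n 1)) (cong +_ (ℕP.+-comm n 1))) ⟩
  + suc n * c         ∎
  where open ≡-Reasoning

Σ-head : ∀ n (f : ℕ → ℤ) → Σℤ (suc n) f ≡ f 0 + Σℤ n (λ i → f (suc i))
Σ-head zero    f = ℤP.+-comm 0ℤ (f 0)
Σ-head (suc n) f = trans (cong (_+ f (suc n)) (Σ-head n f)) (ℤP.+-assoc (f 0) _ _)

Σ-swap : ∀ m n (f : ℕ → ℕ → ℤ) →
  Σℤ m (λ i → Σℤ n (λ j → f i j)) ≡ Σℤ n (λ j → Σℤ m (λ i → f i j))
Σ-swap zero    n f = sym (Σ-zero n (λ _ _ → refl))
Σ-swap (suc m) n f = trans (cong (_+ Σℤ n (f m)) (Σ-swap m n f))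
                           (sym (Σ-+ n (λ j → Σℤ m (λ i → f i j)) (f m)))

pos-Σ : ∀ n (f : ℕ → ℕ) → + Σℕ n f ≡ Σℤ n (λ i → + f i)
pos-Σ zero    f = refl
pos-Σ (suc n) f = trans (ℤP.pos-+ (Σℕ n f) (f n)) (cong (_+ + f n) (pos-Σ n f))

pos-^ : ∀ m n → + (m ℕ.^ n) ≡ (+ m) ^ n
pos-^ m zero    = refl
pos-^ m (suc n) = trans (ℤP.pos-* m (m ℕ.^ n)) (cong (+ m *_) (pos-^ m n))

absorption : ∀ n k → suc k ℕ.* (suc n C suc k) ≡ suc n ℕ.* (n C k)
absorption zero    zero    = refl
absorption zero    (suc k) =
  trans (cong (suc (suc k) ℕ.*_) (k>n⇒nCk≡0 {1} {suc (suc k)} (s≤s (s≤s z≤n))))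
        (trans (ℕP.*-zeroʳ (suc (suc k))) (sym (cong (1 ℕ.*_) (k>n⇒nCk≡0 {0} {suc k} (s≤s z≤n)))))
absorption (suc n) zero    =
  trans (ℕP.*-identityˡ _) (trans (nC1≡n (suc (suc n))) (sym (ℕP.*-identityʳ (suc (suc n)))))
absorption (suc n) (suc k) = begin
  suc K ℕ.* (suc N C suc K)                       ≡⟨ cong (suc K ℕ.*_) (sym (nCk+nC[k+1]≡[n+1]C[k+1] N K)) ⟩
  suc K ℕ.* (a ℕ.+ b)                             ≡⟨ regroup k a b ⟩
  a ℕ.+ (suc k ℕ.* a ℕ.+ suc K ℕ.* b)             ≡⟨ cong₂ (λ u v → a ℕ.+ (u ℕ.+ v)) (absorption n k) (absorption n K) ⟩
  a ℕ.+ (suc n ℕ.* (n C k) ℕ.+ suc n ℕ.* (n C K)) ≡⟨ cong (a ℕ.+_) (sym (ℕP.*-distribˡ-+ (suc n) (n C k) (n C K))) ⟩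
  a ℕ.+ suc n ℕ.* (n C k ℕ.+ n C K)               ≡⟨ cong (λ z → a ℕ.+ suc n ℕ.* z) (nCk+nC[k+1]≡[n+1]C[k+1] n k) ⟩
  suc N ℕ.* a                                     ∎
  where
  open ≡-Reasoning
  N = suc n
  K = suc k
  a = N C K
  b = N C suc K
  regroup : ∀ k a b → suc (suc k) ℕ.* (a ℕ.+ b) ≡ a ℕ.+ (suc k ℕ.* a ℕ.+ suc (suc k) ℕ.* b)
  regroup = ℕRing.solve-∀

-- Complementary absorption C(M+1,j)·(M+1−j) = (M+1)·C(M,j), via the symmetry C(n,k) = C(n,n−k).
absorption-complement : ∀ {M j} → j ≤ M → (suc M C j) ℕ.* (suc M ∸ j) ≡ suc M ℕ.* (M C j)
absorption-complement {M} {j} j≤M = begin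
  (suc M C j) ℕ.* (suc M ∸ j)   ≡⟨ cong₂ ℕ._*_ (nCk≡nC[n∸k] (ℕP.m≤n⇒m≤1+n j≤M)) [M+1-j]≡1+m ⟩
  (suc M C (suc M ∸ j)) ℕ.* suc m ≡⟨ cong (λ i → (suc M C i) ℕ.* suc m) [M+1-j]≡1+m ⟩
  (suc M C suc m) ℕ.* suc m     ≡⟨ ℕP.*-comm (suc M C suc m) (suc m) ⟩
  suc m ℕ.* (suc M C suc m)     ≡⟨ absorption M m ⟩
  suc M ℕ.* (M C m)             ≡⟨ cong (suc M ℕ.*_) (sym (nCk≡nC[n∸k] j≤M)) ⟩
  suc M ℕ.* (M C j)             ∎
  where
  open ≡-Reasoning
  m = M ∸ j
  [M+1-j]≡1+m : suc M ∸ j ≡ suc m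
  [M+1-j]≡1+m = ℕP.+-∸-assoc 1 j≤M

binomial : ∀ n x → (x + 1ℤ) ^ n ≡ Σℤ (suc n) (λ k → + (n C k) * x ^ k)
binomial zero    x = refl
binomial (suc n) x = begin
  (x + 1ℤ) * (x + 1ℤ) ^ n                        ≡⟨ cong ((x + 1ℤ) *_) (binomial n x) ⟩
  (x + 1ℤ) * Σℤ (suc n) T                         ≡⟨ ℤP.*-distribʳ-+ (Σℤ (suc n) T) x 1ℤ ⟩
  x * Σℤ (suc n) T + 1ℤ * Σℤ (suc n) T            ≡⟨ cong₂ _+_ (Σ-*ˡ (suc n) x T) (trans (ℤP.*-identityˡ _) T-shift) ⟩
  Σℤ (suc n) (λ k → x * T k) + (1ℤ + Σℤ (suc n) (λ k → T (suc k)))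
                                                   ≡⟨ exchange (Σℤ (suc n) (λ k → x * T k)) 1ℤ (Σℤ (suc n) (λ k → T (suc k))) ⟩
  1ℤ + (Σℤ (suc n) (λ k → x * T k) + Σℤ (suc n) (λ k → T (suc k)))
                                                   ≡⟨ cong (_+_ 1ℤ) (sym (Σ-+ (suc n) (λ k → x * T k) (λ k → T (suc k)))) ⟩
  1ℤ + Σℤ (suc n) (λ k → x * T k + T (suc k))    ≡⟨ cong (_+_ 1ℤ) (Σ-cong (suc n) (λ k _ → pascal-term k)) ⟩
  1ℤ + Σℤ (suc n) (λ k → R (suc k))              ≡⟨ sym (Σ-head (suc n) R) ⟩
  Σℤ (suc (suc n)) R                               ∎
  where
  open ≡-Reasoning
  T R : ℕ → ℤ
  T k = + (n C k) * x ^ k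
  R k = + (suc n C k) * x ^ k
  exchange : ∀ a b c → a + (b + c) ≡ b + (a + c)
  exchange = solve-∀
  -- The summand of index n+1 vanishes, so the sum may be shifted by one place.
  T-shift : Σℤ (suc n) T ≡ 1ℤ + Σℤ (suc n) (λ k → T (suc k))
  T-shift = begin
    Σℤ (suc n) T                                ≡⟨ Σ-head n T ⟩
    1ℤ + Σℤ n (λ k → T (suc k))                 ≡⟨ cong (_+_ 1ℤ) (sym (ℤP.+-identityʳ (Σℤ n (λ k → T (suc k))))) ⟩
    1ℤ + (Σℤ n (λ k → T (suc k)) + 0ℤ)          ≡⟨ cong (λ t → 1ℤ + (Σℤ n (λ k → T (suc k)) + t)) (sym T[n+1]≡0) ⟩
    1ℤ + Σℤ (suc n) (λ k → T (suc k))           ∎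
    where
    T[n+1]≡0 : T (suc n) ≡ 0ℤ
    T[n+1]≡0 = cong (λ c → + c * x ^ suc n) (k>n⇒nCk≡0 (ℕP.n<1+n n))
  pascal-term : ∀ k → x * T k + T (suc k) ≡ R (suc k)
  pascal-term k = begin
    x * (+ (n C k) * x ^ k) + + (n C suc k) * x ^ suc k  ≡⟨ distrib (+ (n C k)) (+ (n C suc k)) x (x ^ k) ⟩
    (+ (n C k) + + (n C suc k)) * x ^ suc k              ≡⟨ cong (_* x ^ suc k) (sym (ℤP.pos-+ (n C k) (n C suc k))) ⟩
    + (n C k ℕ.+ n C suc k) * x ^ suc k                  ≡⟨ cong (λ c → + c * x ^ suc k) (nCk+nC[k+1]≡[n+1]C[k+1] n k) ⟩
    + (suc n C suc k) * x ^ suc k                        ∎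
    where
    distrib : ∀ a b x y → x * (a * y) + b * (x * y) ≡ (a + b) * (x * y)
    distrib = solve-∀

-- Alternating row sums of Pascal's triangle vanish: Σ_j C(M+1,j)(−1)ʲ = (−1+1)^{M+1} = 0.
alternating-binomial : ∀ M → Σℤ (suc (suc M)) (λ j → + (suc M C j) * sgn j) ≡ 0ℤ
alternating-binomial M = trans (sym (binomial (suc M) ℤ.-1ℤ)) (ℤP.*-zeroˡ ((ℤ.-1ℤ + 1ℤ) ^ M))

lookup-∷ʳ : ∀ {A : Set} {n} (xs : Vec A n) x (k : Fin (suc n)) →
  (∃[ k′ ] toℕ k ≡ toℕ k′ × lookup (xs ∷ʳ x) k ≡ lookup xs k′) ⊎ (toℕ k ≡ n × lookup (xs ∷ʳ x) k ≡ x)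
lookup-∷ʳ []       x fzero    = inj₂ (refl , refl)
lookup-∷ʳ (y ∷ xs) x fzero    = inj₁ (fzero , refl , refl)
lookup-∷ʳ (y ∷ xs) x (fsuc k) with lookup-∷ʳ xs x k
... | inj₁ (k′ , toℕ-eq , lookup-eq) = inj₁ (fsuc k′ , cong suc toℕ-eq , lookup-eq)
... | inj₂ (toℕ-eq , lookup-eq)      = inj₂ (cong suc toℕ-eq , lookup-eq)

bellNext : ℕ → ℕ
bellNext n = Vec.sum (tabulate λ (k : Fin (suc n)) → (n C toℕ k) ℕ.* lookup (bellTable n) k)

bell-suc : ∀ n → bell (suc n) ≡ bellNext n
bell-suc n = VecP.last-∷ʳ (bellNext n) (bellTable n)

lookup-bellTable : ∀ n (k : Fin (suc n)) → lookup (bellTable n) k ≡ bell (toℕ k)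
lookup-bellTable zero    fzero = refl
lookup-bellTable (suc n) k with lookup-∷ʳ (bellTable n) (bellNext n) k
... | inj₁ (k′ , toℕ-eq , lookup-eq) = trans lookup-eq (trans (lookup-bellTable n k′) (cong bell (sym toℕ-eq)))
... | inj₂ (toℕ-eq , lookup-eq)      = trans lookup-eq (trans (sym (bell-suc n)) (cong bell (sym toℕ-eq)))

sum-tabulate : ∀ n (h : ℕ → ℕ) → Vec.sum (tabulate {n = n} (λ k → h (toℕ k))) ≡ Σℕ n h
sum-tabulate zero    h = refl
sum-tabulate (suc n) h = trans (cong (h 0 ℕ.+_) (sum-tabulate n (λ i → h (suc i)))) (sym (Σℕ-head n h))
  where
  Σℕ-head : ∀ n (f : ℕ → ℕ) → Σℕ (suc n) f ≡ f 0 ℕ.+ Σℕ n (λ i → f (suc i))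
  Σℕ-head zero    f = ℕP.+-comm 0 (f 0)
  Σℕ-head (suc n) f = trans (cong (ℕ._+ f (suc n)) (Σℕ-head n f)) (ℕP.+-assoc (f 0) _ _)

bell-recurrence : ∀ n → bell (suc n) ≡ Σℕ (suc n) (λ k → (n C k) ℕ.* bell k)
bell-recurrence n = begin
  bell (suc n)
    ≡⟨ bell-suc n ⟩
  Vec.sum (tabulate λ (k : Fin (suc n)) → (n C toℕ k) ℕ.* lookup (bellTable n) k)
    ≡⟨ cong Vec.sum (VecP.tabulate-cong (λ k → cong ((n C toℕ k) ℕ.*_) (lookup-bellTable n k))) ⟩
  Vec.sum (tabulate λ (k : Fin (suc n)) → (n C toℕ k) ℕ.* bell (toℕ k))
    ≡⟨ sum-tabulate (suc n) (λ k → (n C k) ℕ.* bell k) ⟩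
  Σℕ (suc n) (λ k → (n C k) ℕ.* bell k) ∎
  where open ≡-Reasoning

sgn-square : ∀ n → sgn n * sgn n ≡ 1ℤ
sgn-square zero    = refl
sgn-square (suc n) = trans (square-neg (sgn n)) (sgn-square n)
  where
  square-neg : ∀ s → (ℤ.-1ℤ * s) * (ℤ.-1ℤ * s) ≡ s * s
  square-neg = solve-∀

-- The derangement recurrence S_{k+1} = (k+1)·S_k + (−1)^{k+1}: each (k+1)!/i! equals (k+1)·k!/i! for i ≤ k.
derangement-suc : ∀ k → derangement (suc k) ≡ + suc k * derangement k + sgn (suc k)
derangement-suc k = begin
  Σℤ (suc k) (λ i → sgn i * + quotient (suc k) i) + sgn (suc k) * + quotient (suc k) (suc k)
    ≡⟨ cong₂ _+_ (Σ-cong (suc k) (λ i i≤k → lower-term i (ℕP.≤-pred i≤k))) top-term ⟩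
  Σℤ (suc k) (λ i → + suc k * (sgn i * + quotient k i)) + sgn (suc k)
    ≡⟨ cong (_+ sgn (suc k)) (sym (Σ-*ˡ (suc k) (+ suc k) (λ i → sgn i * + quotient k i))) ⟩
  + suc k * derangement k + sgn (suc k) ∎
  where
  open ≡-Reasoning
  quotient : ℕ → ℕ → ℕ
  quotient n i = (n ! / i !) {{i !≢0}}
  top-term : sgn (suc k) * + quotient (suc k) (suc k) ≡ sgn (suc k)
  top-term = trans (cong (λ c → sgn (suc k) * + c) (n/n≡1 (suc k !) {{suc k !≢0}})) (ℤP.*-identityʳ _)
  lower-term : ∀ i → i ≤ k → sgn i * + quotient (suc k) i ≡ + suc k * (sgn i * + quotient k i)
  lower-term i i≤k = begin
    sgn i * + quotient (suc k) i            ≡⟨ cong (λ c → sgn i * + c) (*-/-assoc (suc k) {{i !≢0}} (ℕD.m≤n⇒m!∣n! i≤k)) ⟩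
    sgn i * + (suc k ℕ.* quotient k i)      ≡⟨ cong (sgn i *_) (ℤP.pos-* (suc k) (quotient k i)) ⟩
    sgn i * (+ suc k * + quotient k i)      ≡⟨ x∙yz≈y∙xz (sgn i) (+ suc k) (+ quotient k i) ⟩
    + suc k * (sgn i * + quotient k i)      ∎

-- The signed derangement numbers D_k = (−1)ᵏ·S_k, i.e. the right-hand side of the first system.
signedDerangement : ℕ → ℤ
signedDerangement k = sgn k * derangement k

signedDerangement-suc : ∀ k → signedDerangement (suc k) ≡ 1ℤ - + suc k * signedDerangement k
signedDerangement-suc k = begin
  sgn (suc k) * derangement (suc k)                     ≡⟨ cong (sgn (suc k) *_) (derangement-suc k) ⟩
  (ℤ.-1ℤ * sgn k) * (+ suc k * derangement k + ℤ.-1ℤ * sgn k)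
                                                        ≡⟨ expand (sgn k) (+ suc k) (derangement k) ⟩
  sgn k * sgn k - + suc k * (sgn k * derangement k)     ≡⟨ cong (_- + suc k * signedDerangement k) (sgn-square k) ⟩
  1ℤ - + suc k * signedDerangement k                    ∎
  where
  open ≡-Reasoning
  expand : ∀ s a d → (ℤ.-1ℤ * s) * (a * d + ℤ.-1ℤ * s) ≡ s * s - a * (s * d)
  expand = solve-∀

binomialMoment : (ℕ → ℤ) → ℕ → ℕ → ℤ
binomialMoment a N n = Σℤ (suc N) (λ j → + (N C j) * (+ ((N ∸ j) ℕ.^ n) * a j))

-- One summand of M_{n+1}(a)(M+1): absorbing a factor M+1−j into C(M+1,j) and expanding
-- (M−j+1)ⁿ binomially gives (M+1)·Σ_{k≤n} C(n,k)·C(M,j)·(M−j)ᵏ·a_j.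
binomialMoment-summand : ∀ (a : ℕ → ℤ) M n {j} → j ≤ M →
  + (suc M C j) * (+ ((suc M ∸ j) ℕ.^ suc n) * a j) ≡
  + suc M * Σℤ (suc n) (λ k → + (n C k) * (+ (M C j) * (+ ((M ∸ j) ℕ.^ k) * a j)))
binomialMoment-summand a M n {j} j≤M = begin
  + (suc M C j) * (+ ((suc M ∸ j) ℕ.^ suc n) * a j)
    ≡⟨ cong (λ e → + (suc M C j) * (+ (e ℕ.^ suc n) * a j)) (ℕP.+-∸-assoc 1 j≤M) ⟩
  + (suc M C j) * (+ (suc m ℕ.* suc m ℕ.^ n) * a j)
    ≡⟨ cong (λ c → + (suc M C j) * (c * a j)) (ℤP.pos-* (suc m) (suc m ℕ.^ n)) ⟩
  + (suc M C j) * (+ suc m * + (suc m ℕ.^ n) * a j)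
    ≡⟨ regroup (+ (suc M C j)) (+ suc m) (+ (suc m ℕ.^ n)) (a j) ⟩
  + (suc M C j) * + suc m * (+ (suc m ℕ.^ n) * a j)
    ≡⟨ cong (_* (+ (suc m ℕ.^ n) * a j)) absorbed ⟩
  + suc M * + (M C j) * (+ (suc m ℕ.^ n) * a j)
    ≡⟨ cong (λ c → + suc M * + (M C j) * (c * a j)) (trans (pos-^ (suc m) n) binomial-shift) ⟩
  + suc M * + (M C j) * (Σℤ (suc n) (λ k → + (n C k) * (+ m) ^ k) * a j)
    ≡⟨ ℤP.*-assoc (+ suc M) (+ (M C j)) _ ⟩
  + suc M * (+ (M C j) * (Σℤ (suc n) (λ k → + (n C k) * (+ m) ^ k) * a j))
    ≡⟨ cong (+ suc M *_) distribute ⟩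
  + suc M * Σℤ (suc n) X ∎
  where
  open ≡-Reasoning
  m = M ∸ j
  X : ℕ → ℤ
  X k = + (n C k) * (+ (M C j) * (+ (m ℕ.^ k) * a j))
  regroup : ∀ b s t u → b * (s * t * u) ≡ b * s * (t * u)
  regroup = solve-∀
  absorbed : + (suc M C j) * + suc m ≡ + suc M * + (M C j)
  absorbed = begin
    + (suc M C j) * + suc m         ≡⟨ sym (ℤP.pos-* (suc M C j) (suc m)) ⟩
    + ((suc M C j) ℕ.* suc m)       ≡⟨ cong (λ e → + ((suc M C j) ℕ.* e)) (sym (ℕP.+-∸-assoc 1 j≤M)) ⟩
    + ((suc M C j) ℕ.* (suc M ∸ j)) ≡⟨ cong +_ (absorption-complement j≤M) ⟩
    + (suc M ℕ.* (M C j))           ≡⟨ ℤP.pos-* (suc M) (M C j) ⟩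
    + suc M * + (M C j)             ∎
  binomial-shift : (+ suc m) ^ n ≡ Σℤ (suc n) (λ k → + (n C k) * (+ m) ^ k)
  binomial-shift = trans (cong (λ x → x ^ n) (trans (cong +_ (ℕP.+-comm 1 m)) (ℤP.pos-+ m 1))) (binomial n (+ m))
  distribute : + (M C j) * (Σℤ (suc n) (λ k → + (n C k) * (+ m) ^ k) * a j) ≡ Σℤ (suc n) X
  distribute = begin
    + (M C j) * (Σℤ (suc n) (λ k → + (n C k) * (+ m) ^ k) * a j)
      ≡⟨ cong (+ (M C j) *_) (Σ-*ʳ (suc n) (a j) (λ k → + (n C k) * (+ m) ^ k)) ⟩
    + (M C j) * Σℤ (suc n) (λ k → + (n C k) * (+ m) ^ k * a j)
      ≡⟨ Σ-*ˡ (suc n) (+ (M C j)) _ ⟩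
    Σℤ (suc n) (λ k → + (M C j) * (+ (n C k) * (+ m) ^ k * a j))
      ≡⟨ Σ-cong (suc n) (λ k _ → rearrange k) ⟩
    Σℤ (suc n) X ∎
    where
    rearrange : ∀ k → + (M C j) * (+ (n C k) * (+ m) ^ k * a j) ≡ X k
    rearrange k = trans (cong (λ t → + (M C j) * (+ (n C k) * t * a j)) (sym (pos-^ m k)))
                        (shuffle (+ (M C j)) (+ (n C k)) (+ (m ℕ.^ k)) (a j))
      where
      shuffle : ∀ b c t u → b * (c * t * u) ≡ c * (b * (t * u))
      shuffle = solve-∀

-- The moments obey M_{n+1}(a)(M+1) = (M+1)·Σ_{k≤n} C(n,k)·M_k(a)(M), for every sequence a:
-- expand each summand, note that the summand j = M+1 vanishes, and interchange the sums.
binomialMoment-suc : ∀ a M n →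
  binomialMoment a (suc M) (suc n) ≡ + suc M * Σℤ (suc n) (λ k → + (n C k) * binomialMoment a M k)
binomialMoment-suc a M n = begin
  Σℤ (suc M) summand + summand (suc M)
    ≡⟨ cong₂ _+_ (Σ-cong (suc M) (λ j j≤M → binomialMoment-summand a M n (ℕP.≤-pred j≤M))) last-term ⟩
  Σℤ (suc M) (λ j → + suc M * Σℤ (suc n) (X j)) + 0ℤ
    ≡⟨ ℤP.+-identityʳ _ ⟩
  Σℤ (suc M) (λ j → + suc M * Σℤ (suc n) (X j))
    ≡⟨ sym (Σ-*ˡ (suc M) (+ suc M) (λ j → Σℤ (suc n) (X j))) ⟩
  + suc M * Σℤ (suc M) (λ j → Σℤ (suc n) (X j))
    ≡⟨ cong (+ suc M *_) (Σ-swap (suc M) (suc n) X) ⟩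
  + suc M * Σℤ (suc n) (λ k → Σℤ (suc M) (λ j → X j k))
    ≡⟨ cong (+ suc M *_) (Σ-cong (suc n) (λ k _ → sym (Σ-*ˡ (suc M) (+ (n C k)) (λ j → Y j k)))) ⟩
  + suc M * Σℤ (suc n) (λ k → + (n C k) * binomialMoment a M k) ∎
  where
  open ≡-Reasoning
  summand : ℕ → ℤ
  summand j = + (suc M C j) * (+ ((suc M ∸ j) ℕ.^ suc n) * a j)
  Y X : ℕ → ℕ → ℤ
  Y j k = + (M C j) * (+ ((M ∸ j) ℕ.^ k) * a j)
  X j k = + (n C k) * Y j k
  last-term : summand (suc M) ≡ 0ℤ
  last-term = begin
    + (suc M C suc M) * (+ ((suc M ∸ suc M) ℕ.^ suc n) * a (suc M))
      ≡⟨ cong (λ e → + (suc M C suc M) * (+ (e ℕ.^ suc n) * a (suc M))) (ℕP.n∸n≡0 M) ⟩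
    + (suc M C suc M) * (0ℤ * a (suc M))
      ≡⟨ cong (+ (suc M C suc M) *_) (ℤP.*-zeroˡ (a (suc M))) ⟩
    + (suc M C suc M) * 0ℤ
      ≡⟨ ℤP.*-zeroʳ (+ (suc M C suc M)) ⟩
    0ℤ ∎

-- M_0(S)(N) = Σ_j C(N,j)·S_j = N!: the derangement recurrence and absorption reduce level N+1 to
-- (N+1)·M_0(S)(N) plus an alternating binomial sum, which vanishes.
moment₀-derangement : ∀ N → binomialMoment derangement N 0 ≡ + (N !)
moment₀-derangement zero    = refl
moment₀-derangement (suc M) = begin
  Σℤ (suc (suc M)) h
    ≡⟨ Σ-head (suc M) h ⟩
  h 0 + Σℤ (suc M) (λ j → h (suc j))
    ≡⟨ cong (_+_ (h 0)) (Σ-cong (suc M) (λ j _ → h-suc j)) ⟩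
  h 0 + Σℤ (suc M) (λ j → + suc M * f j + g (suc j))
    ≡⟨ cong (_+_ (h 0)) (Σ-+ (suc M) (λ j → + suc M * f j) (λ j → g (suc j))) ⟩
  h 0 + (Σℤ (suc M) (λ j → + suc M * f j) + Σℤ (suc M) (λ j → g (suc j)))
    ≡⟨ cong (λ t → h 0 + (t + Σℤ (suc M) (λ j → g (suc j)))) (sym (Σ-*ˡ (suc M) (+ suc M) f)) ⟩
  g 0 + (+ suc M * binomialMoment derangement M 0 + Σℤ (suc M) (λ j → g (suc j)))
    ≡⟨ exchange (g 0) (+ suc M * binomialMoment derangement M 0) _ ⟩
  + suc M * binomialMoment derangement M 0 + (g 0 + Σℤ (suc M) (λ j → g (suc j)))
    ≡⟨ cong₂ _+_ (cong (+ suc M *_) (moment₀-derangement M)) alternating ⟩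
  + suc M * + (M !) + 0ℤ
    ≡⟨ ℤP.+-identityʳ _ ⟩
  + suc M * + (M !)
    ≡⟨ sym (ℤP.pos-* (suc M) (M !)) ⟩
  + (suc M !) ∎
  where
  open ≡-Reasoning
  h f g : ℕ → ℤ
  h j = + (suc M C j) * (1ℤ * derangement j)
  f j = + (M C j) * (1ℤ * derangement j)
  g j = + (suc M C j) * sgn j
  exchange : ∀ a b c → a + (b + c) ≡ b + (a + c)
  exchange = solve-∀
  alternating : g 0 + Σℤ (suc M) (λ j → g (suc j)) ≡ 0ℤ
  alternating = trans (sym (Σ-head (suc M) g)) (alternating-binomial M)
  h-suc : ∀ j → h (suc j) ≡ + suc M * f j + g (suc j)
  h-suc j = begin
    + b * (1ℤ * derangement (suc j))                              ≡⟨ cong (λ d → + b * (1ℤ * d)) (derangement-suc j) ⟩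
    + b * (1ℤ * (+ suc j * derangement j + sgn (suc j)))          ≡⟨ expand (+ b) (+ suc j) (derangement j) (sgn (suc j)) ⟩
    + suc j * + b * derangement j + + b * sgn (suc j)             ≡⟨ cong (λ c → c * derangement j + g (suc j)) absorbed ⟩
    + suc M * + (M C j) * derangement j + g (suc j)               ≡⟨ cong (_+ g (suc j)) (regroup (+ suc M) (+ (M C j)) (derangement j)) ⟩
    + suc M * f j + g (suc j)                                     ∎
    where
    b = suc M C suc j
    expand : ∀ b s x y → b * (1ℤ * (s * x + y)) ≡ s * b * x + b * y
    expand = solve-∀
    regroup : ∀ a b x → a * b * x ≡ a * (b * (1ℤ * x))
    regroup = solve-∀
    absorbed : + suc j * + b ≡ + suc M * + (M C j)
    absorbed = trans (sym (ℤP.pos-* (suc j) b)) (trans (cong +_ (absorption M j)) (ℤP.pos-* (suc M) (M C j)))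

-- The binomial moments of the derangement numbers are M_k(S)(N) = N!·B_k for k ≤ N:
-- by the moment recursion and induction on N this is the Bell recurrence.
moment-derangement : ∀ N k → k ≤ N → binomialMoment derangement N k ≡ + (N ! ℕ.* bell k)
moment-derangement N       zero    _         = trans (moment₀-derangement N) (cong +_ (sym (ℕP.*-identityʳ (N !))))
moment-derangement (suc M) (suc n) (s≤s n≤M) = begin
  binomialMoment derangement (suc M) (suc n)
    ≡⟨ binomialMoment-suc derangement M n ⟩
  + suc M * Σℤ (suc n) (λ k → + (n C k) * binomialMoment derangement M k)
    ≡⟨ cong (+ suc M *_) (Σ-cong (suc n) (λ k k≤n → lower k (ℕP.≤-pred k≤n))) ⟩
  + suc M * Σℤ (suc n) (λ k → + (M !) * + ((n C k) ℕ.* bell k))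
    ≡⟨ cong (+ suc M *_) (sym (Σ-*ˡ (suc n) (+ (M !)) _)) ⟩
  + suc M * (+ (M !) * Σℤ (suc n) (λ k → + ((n C k) ℕ.* bell k)))
    ≡⟨ cong (λ t → + suc M * (+ (M !) * t)) bell-sum ⟩
  + suc M * (+ (M !) * + bell (suc n))
    ≡⟨ sym (ℤP.*-assoc (+ suc M) (+ (M !)) (+ bell (suc n))) ⟩
  + suc M * + (M !) * + bell (suc n)
    ≡⟨ cong (_* + bell (suc n)) (sym (ℤP.pos-* (suc M) (M !))) ⟩
  + (suc M !) * + bell (suc n)
    ≡⟨ sym (ℤP.pos-* (suc M !) (bell (suc n))) ⟩
  + (suc M ! ℕ.* bell (suc n)) ∎
  where
  open ≡-Reasoning
  bell-sum : Σℤ (suc n) (λ k → + ((n C k) ℕ.* bell k)) ≡ + bell (suc n)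
  bell-sum = trans (sym (pos-Σ (suc n) (λ k → (n C k) ℕ.* bell k))) (cong +_ (sym (bell-recurrence n)))
  lower : ∀ k → k ≤ n → + (n C k) * binomialMoment derangement M k ≡ + (M !) * + ((n C k) ℕ.* bell k)
  lower k k≤n = begin
    + (n C k) * binomialMoment derangement M k  ≡⟨ cong (+ (n C k) *_) (moment-derangement M k (ℕP.≤-trans k≤n n≤M)) ⟩
    + (n C k) * + (M ! ℕ.* bell k)              ≡⟨ cong (+ (n C k) *_) (ℤP.pos-* (M !) (bell k)) ⟩
    + (n C k) * (+ (M !) * + bell k)            ≡⟨ x∙yz≈y∙xz (+ (n C k)) (+ (M !)) (+ bell k) ⟩
    + (M !) * (+ (n C k) * + bell k)            ≡⟨ cong (+ (M !) *_) (sym (ℤP.pos-* (n C k) (bell k))) ⟩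
    + (M !) * + ((n C k) ℕ.* bell k)            ∎

-- The binomial moments of the signs (−1)ʲ: M_n(sgn)(N) = 0 for n < N (higher finite differences
-- of a polynomial of low degree vanish) and M_N(sgn)(N) = N!.
moment-sgn-below : ∀ N n → n < N → binomialMoment sgn N n ≡ 0ℤ
moment-sgn-below (suc M) zero    _           =
  trans (Σ-cong (suc (suc M)) (λ j _ → cong (+ (suc M C j) *_) (ℤP.*-identityˡ (sgn j)))) (alternating-binomial M)
moment-sgn-below (suc M) (suc n) (s≤s n<M) = begin
  binomialMoment sgn (suc M) (suc n)                             ≡⟨ binomialMoment-suc sgn M n ⟩
  + suc M * Σℤ (suc n) (λ k → + (n C k) * binomialMoment sgn M k) ≡⟨ cong (+ suc M *_) (Σ-zero (suc n) vanish) ⟩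
  + suc M * 0ℤ                                                   ≡⟨ ℤP.*-zeroʳ (+ suc M) ⟩
  0ℤ                                                             ∎
  where
  open ≡-Reasoning
  vanish : ∀ k → k < suc n → + (n C k) * binomialMoment sgn M k ≡ 0ℤ
  vanish k k≤n = trans (cong (+ (n C k) *_) (moment-sgn-below M k (ℕP.<-≤-trans (s≤s (ℕP.≤-pred k≤n)) n<M)))
                       (ℤP.*-zeroʳ (+ (n C k)))

moment-sgn-diagonal : ∀ N → binomialMoment sgn N N ≡ + (N !)
moment-sgn-diagonal zero    = refl
moment-sgn-diagonal (suc M) = begin
  binomialMoment sgn (suc M) (suc M)                                     ≡⟨ binomialMoment-suc sgn M M ⟩
  + suc M * (Σℤ M (λ k → + (M C k) * binomialMoment sgn M k) + + (M C M) * binomialMoment sgn M M)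
    ≡⟨ cong₂ (λ s c → + suc M * (s + + c * binomialMoment sgn M M)) (Σ-zero M vanish) (nCn≡1 M) ⟩
  + suc M * (0ℤ + 1ℤ * binomialMoment sgn M M)                          ≡⟨ cong (+ suc M *_) (trans (ℤP.+-identityˡ _) (ℤP.*-identityˡ _)) ⟩
  + suc M * binomialMoment sgn M M                                       ≡⟨ cong (+ suc M *_) (moment-sgn-diagonal M) ⟩
  + suc M * + (M !)                                                      ≡⟨ sym (ℤP.pos-* (suc M) (M !)) ⟩
  + (suc M !)                                                            ∎
  where
  open ≡-Reasoning
  vanish : ∀ k → k < M → + (M C k) * binomialMoment sgn M k ≡ 0ℤ
  vanish k k<M = trans (cong (+ (M C k) *_) (moment-sgn-below M k k<M)) (ℤP.*-zeroʳ (+ (M C k)))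

geometricSum : ℤ → ℤ → ℕ → ℤ
geometricSum x y m = Σℤ m (λ j → x ^ (m ∸ j) * y ^ j)

geometricSum-telescope : ∀ x y m → (x - y) * geometricSum x y m ≡ x ^ suc m - x * y ^ m
geometricSum-telescope x y zero    = cancel x y
  where
  cancel : ∀ x y → (x - y) * 0ℤ ≡ x * 1ℤ - x * 1ℤ
  cancel = solve-∀
geometricSum-telescope x y (suc m) = begin
  (x - y) * (Σℤ m (λ j → x ^ (suc m ∸ j) * y ^ j) + x ^ (suc m ∸ m) * y ^ m)
    ≡⟨ cong₂ (λ s e → (x - y) * (s + x ^ e * y ^ m)) factor-x (ℕP.m+n∸n≡m 1 m) ⟩
  (x - y) * (x * geometricSum x y m + x * 1ℤ * y ^ m) ≡⟨ expand x y (geometricSum x y m) (y ^ m) ⟩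
  x * ((x - y) * geometricSum x y m) + (x - y) * x * y ^ m
    ≡⟨ cong (λ t → x * t + (x - y) * x * y ^ m) (geometricSum-telescope x y m) ⟩
  x * (x * x ^ m - x * y ^ m) + (x - y) * x * y ^ m  ≡⟨ collect x y (x ^ m) (y ^ m) ⟩
  x * (x * x ^ m) - x * (y * y ^ m)                  ∎
  where
  open ≡-Reasoning
  factor-x : Σℤ m (λ j → x ^ (suc m ∸ j) * y ^ j) ≡ x * geometricSum x y m
  factor-x = trans (Σ-cong m (λ j j<m → trans (cong (λ e → x ^ e * y ^ j) (ℕP.+-∸-assoc 1 (ℕP.<⇒≤ j<m)))
                                              (ℤP.*-assoc x (x ^ (m ∸ j)) (y ^ j))))
                   (sym (Σ-*ˡ m x (λ j → x ^ (m ∸ j) * y ^ j)))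
  expand : ∀ x y g b → (x - y) * (x * g + x * 1ℤ * b) ≡ x * ((x - y) * g) + (x - y) * x * b
  expand = solve-∀
  collect : ∀ x y a b → x * (x * a - x * b) + (x - y) * x * b ≡ x * (x * a) - x * (y * b)
  collect = solve-∀

module Congruence (p : ℕ) where

  infix 4 _≈_
  record _≈_ (x y : ℤ) : Set where
    constructor mkCong
    field divides-difference : + p ℤD.∣ (x - y)

  private
    by : ∀ {u v} → u ≡ v → + p ℤD.∣ u → + p ℤD.∣ v
    by = subst (+ p ℤD.∣_)

  ≡⇒≈ : ∀ {x y} → x ≡ y → x ≈ y
  ≡⇒≈ {x} refl = mkCong (divides 0ℤ (trans (ℤP.+-inverseʳ x) (sym (ℤP.*-zeroˡ (+ p)))))

  ≈-refl : ∀ {x} → x ≈ x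
  ≈-refl = ≡⇒≈ refl

  ≈-sym : ∀ {x y} → x ≈ y → y ≈ x
  ≈-sym {x} {y} (mkCong d) = mkCong (by (negate x y) (ℤD.∣m⇒∣-m d))
    where
    negate : ∀ x y → - (x - y) ≡ y - x
    negate = solve-∀

  ≈-trans : ∀ {x y z} → x ≈ y → y ≈ z → x ≈ z
  ≈-trans {x} {y} {z} (mkCong d) (mkCong e) = mkCong (by (chain x y z) (ℤD.∣m∣n⇒∣m+n d e))
    where
    chain : ∀ x y z → (x - y) + (y - z) ≡ x - z
    chain = solve-∀

  ≈-setoid : Setoid _ _
  ≈-setoid = record { Carrier = ℤ ; _≈_ = _≈_ ; isEquivalence = record { refl = ≈-refl ; sym = ≈-sym ; trans = ≈-trans } }

  +-cong : ∀ {a b c d} → a ≈ b → c ≈ d → a + c ≈ b + d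
  +-cong {a} {b} {c} {d} (mkCong e) (mkCong f) = mkCong (by (regroup a b c d) (ℤD.∣m∣n⇒∣m+n e f))
    where
    regroup : ∀ a b c d → (a - b) + (c - d) ≡ (a + c) - (b + d)
    regroup = solve-∀

  *-cong : ∀ {a b c d} → a ≈ b → c ≈ d → a * c ≈ b * d
  *-cong {a} {b} {c} {d} (mkCong e) (mkCong f) =
    mkCong (by (regroup a b c d) (ℤD.∣m∣n⇒∣m+n (ℤD.∣m⇒∣m*n c e) (ℤD.∣n⇒∣m*n b f)))
    where
    regroup : ∀ a b c d → (a - b) * c + b * (c - d) ≡ a * c - b * d
    regroup = solve-∀

  neg-cong : ∀ {a b} → a ≈ b → - a ≈ - b
  neg-cong {a} {b} (mkCong e) = mkCong (by (negate a b) (ℤD.∣m⇒∣-m e))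
    where
    negate : ∀ a b → - (a - b) ≡ - a - - b
    negate = solve-∀

  modulus≈0 : + p ≈ 0ℤ
  modulus≈0 = mkCong (divides 1ℤ (trans (ℤP.+-identityʳ (+ p)) (sym (ℤP.*-identityˡ (+ p)))))

  Σ-cong≈ : ∀ n {f g : ℕ → ℤ} → (∀ i → i < n → f i ≈ g i) → Σℤ n f ≈ Σℤ n g
  Σ-cong≈ zero    eq = ≈-refl
  Σ-cong≈ (suc n) eq = +-cong (Σ-cong≈ n (λ i i<n → eq i (ℕP.m<n⇒m<1+n i<n))) (eq n ℕP.≤-refl)

  Σ-zero≈ : ∀ n {f : ℕ → ℤ} → (∀ i → i < n → f i ≈ 0ℤ) → Σℤ n f ≈ 0ℤ
  Σ-zero≈ n eq = ≈-trans (Σ-cong≈ n eq) (≡⇒≈ (Σ-zero n (λ _ _ → refl)))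

  Σ-single≈ : ∀ n k {f : ℕ → ℤ} → k < n → (∀ m → m < n → m ≢ k → f m ≈ 0ℤ) → Σℤ n f ≈ f k
  Σ-single≈ (suc n) k {f} k<1+n vanish with k ℕ.≟ n
  ... | yes refl = ≈-trans (+-cong (Σ-zero≈ n (λ m m<n → vanish m (ℕP.m<n⇒m<1+n m<n) (ℕP.<⇒≢ m<n))) (≈-refl {f n}))
                           (≡⇒≈ (ℤP.+-identityˡ (f n)))
  ... | no  k≢n  = ≈-trans (+-cong (Σ-single≈ n k (ℕP.≤∧≢⇒< (ℕP.≤-pred k<1+n) k≢n) (λ m m<n → vanish m (ℕP.m<n⇒m<1+n m<n)))
                                   (vanish n ℕP.≤-refl (λ n≡k → k≢n (sym n≡k))))
                           (≡⇒≈ (ℤP.+-identityʳ (f k)))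

  difference≈0⇒≈ : ∀ {x y} → x - y ≈ 0ℤ → x ≈ y
  difference≈0⇒≈ {x} {y} (mkCong e) = mkCong (by (ℤP.+-identityʳ (x - y)) e)

  ≈⇒difference≈0 : ∀ {x y} → x ≈ y → x - y ≈ 0ℤ
  ≈⇒difference≈0 {x} {y} (mkCong e) = mkCong (by (sym (ℤP.+-identityʳ (x - y))) e)

  +-absorbs⇒≈0 : ∀ {x y} → x + y ≈ x → y ≈ 0ℤ
  +-absorbs⇒≈0 {x} {y} (mkCong e) = mkCong (by (cancel x y) e)
    where
    cancel : ∀ x y → (x + y) - x ≡ y - 0ℤ
    cancel = solve-∀

  ≈⇒≡[mod] : ∀ {x y} → x ≈ y → x ≡ y [mod p ]
  ≈⇒≡[mod] (mkCong e) = ∣⇒∣ᵤ e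

  ≡[mod]⇒≈ : ∀ {x y} → x ≡ y [mod p ] → x ≈ y
  ≡[mod]⇒≈ e = mkCong (∣ᵤ⇒∣ e)

  ≈0⇒∣ : ∀ {x} → x ≈ 0ℤ → p ∣ ℤ.∣ x ∣
  ≈0⇒∣ {x} (mkCong e) = subst (λ z → p ∣ ℤ.∣ z ∣) (ℤP.+-identityʳ x) (∣⇒∣ᵤ e)

  ∣⇒≈0 : ∀ {x} → p ∣ ℤ.∣ x ∣ → x ≈ 0ℤ
  ∣⇒≈0 {x} d = mkCong (∣ᵤ⇒∣ (subst (λ z → p ∣ ℤ.∣ z ∣) (sym (ℤP.+-identityʳ x)) d))

module PrimeModulus (r : ℕ) (p-prime : Prime (suc (suc r))) where

  q p : ℕ
  q = suc r
  p = suc q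

  open Congruence p public
  open import Relation.Binary.Reasoning.Setoid ≈-setoid

  cancel-nonzero : ∀ {x y} → ¬ (x ≈ 0ℤ) → x * y ≈ 0ℤ → y ≈ 0ℤ
  cancel-nonzero {x} {y} x≉0 xy≈0
    with euclidsLemma ℤ.∣ x ∣ ℤ.∣ y ∣ p-prime (subst (p ∣_) (ℤP.abs-* x y) (≈0⇒∣ xy≈0))
  ... | inj₁ p∣x = ⊥-elim (x≉0 (∣⇒≈0 p∣x))
  ... | inj₂ p∣y = ∣⇒≈0 p∣y

  nonzero-residue : ∀ {a} → 0 < a → a < p → ¬ (+ a ≈ 0ℤ)
  nonzero-residue {suc a} _ a<p a≈0 = ℕD.>⇒∤ a<p (≈0⇒∣ a≈0)

  private
    residues-distinct-≤ : ∀ {x y} → x ≤ y → y < p → + x ≈ + y → x ≡ y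
    residues-distinct-≤ {x} x≤y y<p x≈y with ℕP.m≤n⇒∃[o]m+o≡n x≤y
    ... | zero  , refl = sym (ℕP.+-identityʳ x)
    ... | suc d , refl = ⊥-elim (nonzero-residue (s≤s z≤n) (ℕP.≤-<-trans (ℕP.m≤n+m (suc d) x) y<p) d≈0)
      where
      cancel : ∀ a b → b ≡ (a + b) - a
      cancel = solve-∀
      shift : + suc d ≡ + (x ℕ.+ suc d) - + x
      shift = trans (cancel (+ x) (+ suc d)) (cong (_- + x) (sym (ℤP.pos-+ x (suc d))))
      d≈0 : + suc d ≈ 0ℤ
      d≈0 = ≈-trans (≡⇒≈ shift) (≈⇒difference≈0 (≈-sym x≈y))

  residues-distinct : ∀ {x y} → x < p → y < p → + x ≈ + y → x ≡ y
  residues-distinct {x} {y} x<p y<p x≈y with ℕP.≤-total x y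
  ... | inj₁ x≤y = residues-distinct-≤ x≤y y<p x≈y
  ... | inj₂ y≤x = sym (residues-distinct-≤ y≤x x<p (≈-sym x≈y))

  q≈-1 : + q ≈ ℤ.-1ℤ
  q≈-1 = begin
    + q             ≡⟨ add-sub (+ q) ⟩
    + q + 1ℤ - 1ℤ   ≡⟨ cong (_- 1ℤ) (trans (sym (ℤP.pos-+ q 1)) (cong +_ (ℕP.+-comm q 1))) ⟩
    + p - 1ℤ        ≈⟨ +-cong modulus≈0 (≈-refl {ℤ.-1ℤ}) ⟩
    0ℤ - 1ℤ         ≡⟨⟩
    ℤ.-1ℤ           ∎
    where
    add-sub : ∀ x → x ≡ x + 1ℤ - 1ℤ
    add-sub = solve-∀

  -- p divides C(p,k) for 0 < k < p: k·C(p,k) = p·C(q,k−1) by absorption, and k is a unit.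
  binomial-prime : ∀ {k} → 0 < k → k < p → + (p C k) ≈ 0ℤ
  binomial-prime {suc k} 0<k k<p = cancel-nonzero (nonzero-residue 0<k k<p) (begin
    + suc k * + (p C suc k)  ≡⟨ sym (ℤP.pos-* (suc k) (p C suc k)) ⟩
    + (suc k ℕ.* (p C suc k)) ≡⟨ cong +_ (absorption q k) ⟩
    + (p ℕ.* (q C k))        ≡⟨ trans (ℤP.pos-* p (q C k)) (ℤP.*-comm (+ p) (+ (q C k))) ⟩
    + (q C k) * + p          ≈⟨ *-cong (≈-refl {+ (q C k)}) modulus≈0 ⟩
    + (q C k) * 0ℤ           ≡⟨ ℤP.*-zeroʳ (+ (q C k)) ⟩
    0ℤ                       ∎)

  -- C(q,j) ≡ (−1)ʲ for j ≤ q, by Pascal's rule C(q,j+1) = C(p,j+1) − C(q,j) ≡ −C(q,j).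
  binomial-pred-prime : ∀ {j} → j ≤ q → + (q C j) ≈ sgn j
  binomial-pred-prime {zero}  _   = ≈-refl
  binomial-pred-prime {suc j} j<q = begin
    + (q C suc j)
      ≡⟨ add-sub (+ (q C j)) (+ (q C suc j)) ⟩
    (+ (q C j) + + (q C suc j)) - + (q C j)
      ≡⟨ cong (_- + (q C j)) (sym (ℤP.pos-+ (q C j) (q C suc j))) ⟩
    + (q C j ℕ.+ q C suc j) - + (q C j)
      ≡⟨ cong (λ c → + c - + (q C j)) (nCk+nC[k+1]≡[n+1]C[k+1] q j) ⟩
    + (p C suc j) - + (q C j)
      ≈⟨ +-cong (binomial-prime (s≤s z≤n) (s≤s j<q)) (neg-cong (binomial-pred-prime (ℕP.<⇒≤ j<q))) ⟩
    0ℤ - sgn j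
      ≡⟨ negate (sgn j) ⟩
    sgn (suc j) ∎
    where
    add-sub : ∀ a b → b ≡ (a + b) - a
    add-sub = solve-∀
    negate : ∀ s → 0ℤ - s ≡ ℤ.-1ℤ * s
    negate = solve-∀

  -- Fermat's little theorem aᵖ ≡ a, by induction on a: (a+1)ᵖ ≡ aᵖ + 1 since p ∣ C(p,k) for 0 < k < p.
  fermat : ∀ a → (+ a) ^ p ≈ + a
  fermat zero    = ≡⇒≈ (ℤP.*-zeroˡ (0ℤ ^ q))
  fermat (suc a) = begin
    (+ suc a) ^ p                                   ≡⟨ cong (_^ p) suc-a ⟩
    (+ a + 1ℤ) ^ p                                  ≡⟨ binomial p (+ a) ⟩
    Σℤ (suc p) T                                    ≡⟨ Σ-head p T ⟩
    1ℤ + (Σℤ q (λ k → T (suc k)) + T p)             ≈⟨ +-cong (≈-refl {1ℤ}) (+-cong (Σ-zero≈ q inner-vanish) (≡⇒≈ top)) ⟩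
    1ℤ + (0ℤ + (+ a) ^ p)                           ≡⟨ cong (_+_ 1ℤ) (ℤP.+-identityˡ ((+ a) ^ p)) ⟩
    1ℤ + (+ a) ^ p                                  ≈⟨ +-cong (≈-refl {1ℤ}) (fermat a) ⟩
    1ℤ + + a                                        ≡⟨ trans (ℤP.+-comm 1ℤ (+ a)) (sym suc-a) ⟩
    + suc a                                         ∎
    where
    T : ℕ → ℤ
    T k = + (p C k) * (+ a) ^ k
    suc-a : + suc a ≡ + a + 1ℤ
    suc-a = trans (cong +_ (ℕP.+-comm 1 a)) (ℤP.pos-+ a 1)
    inner-vanish : ∀ k → k < q → T (suc k) ≈ 0ℤ
    inner-vanish k k<q = ≈-trans (*-cong (binomial-prime (s≤s z≤n) (s≤s k<q)) (≈-refl {(+ a) ^ suc k}))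
                                 (≡⇒≈ (ℤP.*-zeroˡ ((+ a) ^ suc k)))
    top : T p ≡ (+ a) ^ p
    top = trans (cong (λ c → + c * (+ a) ^ p) (nCn≡1 p)) (ℤP.*-identityˡ ((+ a) ^ p))

  -- For a unit a, a^{p−1} ≡ 1: cancel a from a·(a^q − 1) = aᵖ − a ≡ 0.
  fermat-unit : ∀ {a} → 0 < a → a < p → (+ a) ^ q ≈ 1ℤ
  fermat-unit {a} 0<a a<p = difference≈0⇒≈ (cancel-nonzero (nonzero-residue 0<a a<p) (begin
    + a * ((+ a) ^ q - 1ℤ)    ≡⟨ expand (+ a) ((+ a) ^ q) ⟩
    (+ a) ^ p - + a           ≈⟨ ≈⇒difference≈0 (fermat a) ⟩
    0ℤ                        ∎))
    where
    expand : ∀ x y → x * (y - 1ℤ) ≡ x * y - x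
    expand = solve-∀

  -- Wilson's theorem q! ≡ −1: in q! = M_q(sgn)(q) each summand with j < q is
  -- C(q,j)·(q−j)^q·(−1)ʲ ≡ (−1)ʲ·1·(−1)ʲ = 1 and the last one vanishes, so q! ≡ q ≡ −1.
  wilson : + (q !) ≈ ℤ.-1ℤ
  wilson = begin
    + (q !)                         ≡⟨ sym (moment-sgn-diagonal q) ⟩
    Σℤ q W + W q                    ≈⟨ +-cong (Σ-cong≈ q (λ j j<q → W≈1 j j<q)) (≡⇒≈ W[q]≡0) ⟩
    Σℤ q (λ _ → 1ℤ) + 0ℤ            ≡⟨ trans (ℤP.+-identityʳ _) (trans (Σ-const q 1ℤ) (ℤP.*-identityʳ (+ q))) ⟩
    + q                             ≈⟨ q≈-1 ⟩
    ℤ.-1ℤ                           ∎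
    where
    W : ℕ → ℤ
    W j = + (q C j) * (+ ((q ∸ j) ℕ.^ q) * sgn j)
    W[q]≡0 : W q ≡ 0ℤ
    W[q]≡0 = trans (cong (λ e → + (q C q) * (+ (e ℕ.^ q) * sgn q)) (ℕP.n∸n≡0 q))
                   (trans (cong (+ (q C q) *_) (ℤP.*-zeroˡ (sgn q))) (ℤP.*-zeroʳ (+ (q C q))))
    W≈1 : ∀ j → j < q → W j ≈ 1ℤ
    W≈1 j j<q = begin
      + (q C j) * (+ ((q ∸ j) ℕ.^ q) * sgn j)  ≈⟨ *-cong (binomial-pred-prime (ℕP.<⇒≤ j<q)) (*-cong power≈1 (≈-refl {sgn j})) ⟩
      sgn j * (1ℤ * sgn j)                     ≡⟨ cong (sgn j *_) (ℤP.*-identityˡ (sgn j)) ⟩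
      sgn j * sgn j                            ≡⟨ sgn-square j ⟩
      1ℤ                                       ∎
      where
      power≈1 : + ((q ∸ j) ℕ.^ q) ≈ 1ℤ
      power≈1 = ≈-trans (≡⇒≈ (pos-^ (q ∸ j) q)) (fermat-unit (ℕP.m<n⇒0<n∸m j<q) (s≤s (ℕP.m∸n≤m q j)))

  -- Kurepa's left factorial is the last signed derangement number: !p ≡ D_q.  Along j + r = q the
  -- quantity r!·D_j + !r is constant modulo p, since D_{j+1} = 1 − (j+1)·D_j and (j+1) + (r+1) = p.
  leftFactorial-invariant : ∀ j r → j ℕ.+ r ≡ q →
    + (r !) * signedDerangement j + + leftFactorial r ≈ + leftFactorial p
  leftFactorial-invariant zero    r refl = begin
    + (q !) * 1ℤ + + leftFactorial q     ≡⟨ cong (_+ + leftFactorial q) (ℤP.*-identityʳ (+ (q !))) ⟩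
    + (q !) + + leftFactorial q          ≡⟨ ℤP.+-comm (+ (q !)) (+ leftFactorial q) ⟩
    + leftFactorial q + + (q !)          ≡⟨ sym (ℤP.pos-+ (leftFactorial q) (q !)) ⟩
    + leftFactorial p                    ∎
  leftFactorial-invariant (suc j) r j+1+r≡q = begin
    + (r !) * D (suc j) + + leftFactorial r
      ≡⟨ cong (λ d → + (r !) * d + + leftFactorial r) (signedDerangement-suc j) ⟩
    + (r !) * (1ℤ - + suc j * D j) + + leftFactorial r
      ≡⟨ expand (+ (r !)) (D j) (+ suc j) (+ suc r) (+ leftFactorial r) ⟩
    (+ suc r * + (r !) * D j + (+ leftFactorial r + + (r !))) - (+ suc j + + suc r) * (+ (r !) * D j)
      ≡⟨ cong₂ (λ f l → (f * D j + l) - (+ suc j + + suc r) * (+ (r !) * D j))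
               (sym (ℤP.pos-* (suc r) (r !))) (sym (ℤP.pos-+ (leftFactorial r) (r !))) ⟩
    (+ (suc r !) * D j + + leftFactorial (suc r)) - (+ suc j + + suc r) * (+ (r !) * D j)
      ≡⟨ cong (λ s → (+ (suc r !) * D j + + leftFactorial (suc r)) - s * (+ (r !) * D j))
              (sym (ℤP.pos-+ (suc j) (suc r))) ⟩
    (+ (suc r !) * D j + + leftFactorial (suc r)) - + (suc j ℕ.+ suc r) * (+ (r !) * D j)
      ≈⟨ +-cong (leftFactorial-invariant j (suc r) (trans (ℕP.+-suc j r) j+1+r≡q))
                (neg-cong (*-cong sum≈0 (≈-refl {+ (r !) * D j}))) ⟩
    + leftFactorial p - 0ℤ * (+ (r !) * D j)
      ≡⟨ cong (λ t → + leftFactorial p - t) (ℤP.*-zeroˡ (+ (r !) * D j)) ⟩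
    + leftFactorial p - 0ℤ
      ≡⟨ ℤP.+-identityʳ (+ leftFactorial p) ⟩
    + leftFactorial p ∎
    where
    D = signedDerangement
    expand : ∀ R d J R′ L → R * (1ℤ - J * d) + L ≡ (R′ * R * d + (L + R)) - (J + R′) * (R * d)
    expand = solve-∀
    sum≈0 : + (suc j ℕ.+ suc r) ≈ 0ℤ
    sum≈0 = ≈-trans (≡⇒≈ (cong (λ n → + suc n) (trans (ℕP.+-suc j r) j+1+r≡q))) modulus≈0

  leftFactorial≈signedDerangement : + leftFactorial p ≈ signedDerangement q
  leftFactorial≈signedDerangement = begin
    + leftFactorial p                  ≈⟨ ≈-sym (leftFactorial-invariant q 0 (ℕP.+-identityʳ q)) ⟩
    1ℤ * signedDerangement q + 0ℤ      ≡⟨ trans (ℤP.+-identityʳ _) (ℤP.*-identityˡ _) ⟩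
    signedDerangement q                ∎

  -- The central congruence Σ_{j<p} (q−j)ⁿ·D_j ≡ −B_n for n ≤ q: replacing (−1)ʲ by C(q,j) turns
  -- the sum into the binomial moment M_n(S)(q) = q!·B_n, and q! ≡ −1 by Wilson's theorem.
  derangement-moments : ∀ {n} → n ≤ q → Σℤ p (λ j → + ((q ∸ j) ℕ.^ n) * signedDerangement j) ≈ - + bell n
  derangement-moments {n} n≤q = begin
    Σℤ p (λ j → + ((q ∸ j) ℕ.^ n) * signedDerangement j)
      ≈⟨ Σ-cong≈ p (λ j j<p → sign≈binomial j (ℕP.≤-pred j<p)) ⟩
    binomialMoment derangement q n  ≡⟨ moment-derangement q n n≤q ⟩
    + (q ! ℕ.* bell n)              ≡⟨ ℤP.pos-* (q !) (bell n) ⟩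
    + (q !) * + bell n              ≈⟨ *-cong wilson (≈-refl {+ bell n}) ⟩
    ℤ.-1ℤ * + bell n                ≡⟨ ℤP.-1*i≡-i (+ bell n) ⟩
    - + bell n                      ∎
    where
    sign≈binomial : ∀ j → j ≤ q →
      + ((q ∸ j) ℕ.^ n) * signedDerangement j ≈ + (q C j) * (+ ((q ∸ j) ℕ.^ n) * derangement j)
    sign≈binomial j j≤q = begin
      + ((q ∸ j) ℕ.^ n) * (sgn j * derangement j)  ≡⟨ x∙yz≈y∙xz (+ ((q ∸ j) ℕ.^ n)) (sgn j) (derangement j) ⟩
      sgn j * (+ ((q ∸ j) ℕ.^ n) * derangement j)  ≈⟨ *-cong (≈-sym (binomial-pred-prime j≤q)) ≈-refl ⟩
      + (q C j) * (+ ((q ∸ j) ℕ.^ n) * derangement j) ∎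

  -- Modulo p the geometric sums G_q(x,y) for units x detect y:
  -- G_q(x,x) = q·x^q ≡ −1, G_q(x,0) = x^q ≡ 1, and G_q(x,y) ≡ 0 for any other unit y,
  -- because (x − y)·G_q(x,y) = x·x^q − x·y^q ≡ x − x by Fermat.
  geometricSum-diagonal : ∀ {x} → 0 < x → x < p → geometricSum (+ x) (+ x) q ≈ ℤ.-1ℤ
  geometricSum-diagonal {x} 0<x x<p = begin
    geometricSum (+ x) (+ x) q  ≡⟨ Σ-cong q (λ j j<q → merge j (ℕP.<⇒≤ j<q)) ⟩
    Σℤ q (λ _ → (+ x) ^ q)      ≡⟨ Σ-const q ((+ x) ^ q) ⟩
    + q * (+ x) ^ q             ≈⟨ *-cong (≈-refl {+ q}) (fermat-unit 0<x x<p) ⟩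
    + q * 1ℤ                    ≡⟨ ℤP.*-identityʳ (+ q) ⟩
    + q                         ≈⟨ q≈-1 ⟩
    ℤ.-1ℤ                       ∎
    where
    merge : ∀ j → j ≤ q → (+ x) ^ (q ∸ j) * (+ x) ^ j ≡ (+ x) ^ q
    merge j j≤q = trans (sym (ℤP.^-distribˡ-+-* (+ x) (q ∸ j) j)) (cong ((+ x) ^_) (ℕP.m∸n+n≡m j≤q))

  geometricSum-zero : ∀ {x} → 0 < x → x < p → geometricSum (+ x) 0ℤ q ≈ 1ℤ
  geometricSum-zero {x} 0<x x<p = begin
    geometricSum (+ x) 0ℤ q                                          ≡⟨ Σ-head r _ ⟩
    (+ x) ^ q * 1ℤ + Σℤ r (λ j → (+ x) ^ (q ∸ suc j) * 0ℤ ^ suc j)   ≡⟨ cong (_+_ ((+ x) ^ q * 1ℤ)) (Σ-zero r (λ j _ → higher j)) ⟩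
    (+ x) ^ q * 1ℤ + 0ℤ                                              ≡⟨ trans (ℤP.+-identityʳ _) (ℤP.*-identityʳ ((+ x) ^ q)) ⟩
    (+ x) ^ q                                                        ≈⟨ fermat-unit 0<x x<p ⟩
    1ℤ                                                               ∎
    where
    higher : ∀ j → (+ x) ^ (q ∸ suc j) * 0ℤ ^ suc j ≡ 0ℤ
    higher j = trans (cong ((+ x) ^ (q ∸ suc j) *_) (ℤP.*-zeroˡ (0ℤ ^ j))) (ℤP.*-zeroʳ ((+ x) ^ (q ∸ suc j)))

  geometricSum-other : ∀ {x y} → 0 < x → x < p → 0 < y → y < p → y ≢ x → geometricSum (+ x) (+ y) q ≈ 0ℤ
  geometricSum-other {x} {y} 0<x x<p 0<y y<p y≢x = cancel-nonzero x-y≉0 (begin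
    (+ x - + y) * geometricSum (+ x) (+ y) q  ≡⟨ geometricSum-telescope (+ x) (+ y) q ⟩
    + x * (+ x) ^ q - + x * (+ y) ^ q         ≈⟨ +-cong (*-cong (≈-refl {+ x}) (fermat-unit 0<x x<p))
                                                          (neg-cong (*-cong (≈-refl {+ x}) (fermat-unit 0<y y<p))) ⟩
    + x * 1ℤ - + x * 1ℤ                       ≡⟨ ℤP.+-inverseʳ (+ x * 1ℤ) ⟩
    0ℤ                                        ∎)
    where
    x-y≉0 : ¬ (+ x - + y ≈ 0ℤ)
    x-y≉0 x-y≈0 = y≢x (sym (residues-distinct x<p y<p (difference≈0⇒≈ x-y≈0)))

  -- A combination Σ_{j<q} w_j·B_j of Bell numbers, rewritten through the central congruence as a
  -- combination of signed derangement numbers: −Σ_{m<p} (Σ_{j<q} w_j·(q−m)ʲ)·D_m.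
  bell-combination : ∀ (w : ℕ → ℤ) → Σℤ q (λ j → w j * + bell j) ≈
    - Σℤ p (λ m → Σℤ q (λ j → w j * + ((q ∸ m) ℕ.^ j)) * signedDerangement m)
  bell-combination w = begin
    Σℤ q (λ j → w j * + bell j)                      ≈⟨ Σ-cong≈ q (λ j j<q → *-cong (≈-refl {w j}) (bell≈ j (ℕP.<⇒≤ j<q))) ⟩
    Σℤ q (λ j → w j * - Σℤ p (λ m → T m j))          ≡⟨ Σ-cong q (λ j _ → pull-out j) ⟩
    Σℤ q (λ j → - Σℤ p (λ m → w j * T m j))          ≡⟨ sym (Σ-neg q _) ⟩
    - Σℤ q (λ j → Σℤ p (λ m → w j * T m j))          ≡⟨ cong -_ (Σ-swap q p (λ j m → w j * T m j)) ⟩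
    - Σℤ p (λ m → Σℤ q (λ j → w j * T m j))          ≡⟨ cong -_ (Σ-cong p (λ m _ → factor m)) ⟩
    - Σℤ p (λ m → Σℤ q (λ j → w j * + ((q ∸ m) ℕ.^ j)) * signedDerangement m) ∎
    where
    T : ℕ → ℕ → ℤ
    T m j = + ((q ∸ m) ℕ.^ j) * signedDerangement m
    bell≈ : ∀ j → j ≤ q → + bell j ≈ - Σℤ p (λ m → T m j)
    bell≈ j j≤q = ≈-trans (≡⇒≈ (sym (ℤP.neg-involutive (+ bell j)))) (neg-cong (≈-sym (derangement-moments j≤q)))
    pull-out : ∀ j → w j * - Σℤ p (λ m → T m j) ≡ - Σℤ p (λ m → w j * T m j)
    pull-out j = trans (sym (ℤP.neg-distribʳ-* (w j) _)) (cong -_ (Σ-*ˡ p (w j) (λ m → T m j)))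
    factor : ∀ m → Σℤ q (λ j → w j * T m j) ≡ Σℤ q (λ j → w j * + ((q ∸ m) ℕ.^ j)) * signedDerangement m
    factor m = trans (Σ-cong q (λ j _ → sym (ℤP.*-assoc (w j) _ _))) (sym (Σ-*ʳ q _ _))

  -- Row k+1 of the first system: with x = q − k the coefficients are x^{q−j} (the first one since
  -- x^q ≡ 1), so the row is −Σ_m G_q(x, q−m)·D_m, and only m = k and m = q survive.
  systemA-row : ∀ {k} → k < q →
    Σℤ q (λ j → matA p (suc k) (suc j) * + bell j) ≈ signedDerangement k - signedDerangement q
  systemA-row {k} k<q = begin
    Σℤ q (λ j → matA p (suc k) (suc j) * + bell j)
      ≈⟨ Σ-cong≈ q (λ j _ → *-cong (coefficient j) (≈-refl {+ bell j})) ⟩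
    Σℤ q (λ j → X ^ (q ∸ j) * + bell j)
      ≈⟨ bell-combination (λ j → X ^ (q ∸ j)) ⟩
    - Σℤ p (λ m → Σℤ q (λ j → X ^ (q ∸ j) * + ((q ∸ m) ℕ.^ j)) * D m)
      ≡⟨ cong -_ (Σ-cong p (λ m _ → cong (_* D m) (Σ-cong q (λ j _ → cong (X ^ (q ∸ j) *_) (pos-^ (q ∸ m) j))))) ⟩
    - Σℤ p (λ m → geometricSum X (+ (q ∸ m)) q * D m)
      ≈⟨ neg-cong (+-cong below-q at-q) ⟩
    - (ℤ.-1ℤ * D k + 1ℤ * D q)
      ≡⟨ simplify (D k) (D q) ⟩
    D k - D q ∎
    where
    D = signedDerangement
    x = q ∸ k
    X = + x
    0<x : 0 < x
    0<x = ℕP.m<n⇒0<n∸m k<q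
    x<p : x < p
    x<p = s≤s (ℕP.m∸n≤m q k)
    coefficient : ∀ j → matA p (suc k) (suc j) ≈ X ^ (q ∸ j)
    coefficient zero    = ≈-sym (fermat-unit 0<x x<p)
    coefficient (suc j) = ≡⇒≈ (pos-^ x (q ∸ suc j))
    -- Among m < q only m = k contributes, since q − m is then a unit different from x.
    below-q : Σℤ q (λ m → geometricSum X (+ (q ∸ m)) q * D m) ≈ ℤ.-1ℤ * D k
    below-q = ≈-trans (Σ-single≈ q k k<q off-diagonal) (*-cong (geometricSum-diagonal 0<x x<p) (≈-refl {D k}))
      where
      off-diagonal : ∀ m → m < q → m ≢ k → geometricSum X (+ (q ∸ m)) q * D m ≈ 0ℤ
      off-diagonal m m<q m≢k = ≈-trans
        (*-cong (geometricSum-other 0<x x<p (ℕP.m<n⇒0<n∸m m<q) (s≤s (ℕP.m∸n≤m q m))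
                  (λ q-m≡q-k → m≢k (ℕP.∸-cancelˡ-≡ (ℕP.<⇒≤ m<q) (ℕP.<⇒≤ k<q) q-m≡q-k)))
                (≈-refl {D m}))
        (≡⇒≈ (ℤP.*-zeroˡ (D m)))
    at-q : geometricSum X (+ (q ∸ q)) q * D q ≈ 1ℤ * D q
    at-q = *-cong (≈-trans (≡⇒≈ (cong (λ e → geometricSum X (+ e) q) (ℕP.n∸n≡0 q))) (geometricSum-zero 0<x x<p))
                  (≈-refl {D q})
    simplify : ∀ a b → - (ℤ.-1ℤ * a + 1ℤ * b) ≡ a - b
    simplify = solve-∀

  systemC-row : ∀ {n} → n ≤ q →
    Σℤ q (λ j → matC p (suc n) (suc j) * (sgn (suc j) * derangement j)) ≈ + bell n + + (0 ℕ.^ n) * signedDerangement q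
  systemC-row {n} n≤q = begin
    Σℤ q (λ j → matC p (suc n) (suc j) * (sgn (suc j) * derangement j))
      ≡⟨⟩
    Σℤ q (λ j → + ((q ∸ j) ℕ.^ n) * (sgn (suc j) * derangement j))
      ≡⟨ trans (Σ-cong q (λ j _ → sign-out (+ ((q ∸ j) ℕ.^ n)) (sgn j) (derangement j))) (sym (Σ-neg q _)) ⟩
    - A                                       ≡⟨ rearrange A last (+ bell n) ⟩
    + bell n + last - (A + last + + bell n)   ≈⟨ +-cong (≈-refl {+ bell n + last}) (neg-cong full-sum) ⟩
    + bell n + last - 0ℤ                      ≡⟨ ℤP.+-identityʳ _ ⟩
    + bell n + last                           ∎
    where
    A last : ℤ
    A    = Σℤ q (λ j → + ((q ∸ j) ℕ.^ n) * signedDerangement j)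
    last = + (0 ℕ.^ n) * signedDerangement q
    sign-out : ∀ t s d → t * (ℤ.-1ℤ * s * d) ≡ - (t * (s * d))
    sign-out = solve-∀
    rearrange : ∀ a b c → - a ≡ c + b - (a + b + c)
    rearrange = solve-∀
    full-sum : A + last + + bell n ≈ 0ℤ
    full-sum = begin
      A + last + + bell n
        ≡⟨ cong (λ e → A + + (e ℕ.^ n) * signedDerangement q + + bell n) (sym (ℕP.n∸n≡0 q)) ⟩
      Σℤ p (λ j → + ((q ∸ j) ℕ.^ n) * signedDerangement j) + + bell n
        ≈⟨ +-cong (derangement-moments n≤q) (≈-refl {+ bell n}) ⟩
      - + bell n + + bell n
        ≡⟨ ℤP.+-inverseˡ (+ bell n) ⟩
      0ℤ ∎

  kurepa⇔D≈0 : (p ∣ leftFactorial p) ⇔ (signedDerangement q ≈ 0ℤ)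
  kurepa⇔D≈0 = mk⇔ (λ p∣!p → ≈-trans (≈-sym leftFactorial≈signedDerangement) (∣⇒≈0 p∣!p))
                   (λ D≈0 → ≈0⇒∣ (≈-trans leftFactorial≈signedDerangement D≈0))

  -- Rows of the first system read D_k − D_q ≡ D_k; the first row forces D_q ≡ 0.
  systemA⇔D≈0 : SystemA p ⇔ (signedDerangement q ≈ 0ℤ)
  systemA⇔D≈0 = mk⇔ from-first-row all-rows
    where
    D = signedDerangement
    from-first-row : SystemA p → D q ≈ 0ℤ
    from-first-row system = ≈-trans (≡⇒≈ (sym (ℤP.neg-involutive (D q)))) (neg-cong (+-absorbs⇒≈0
      (≈-trans (≈-sym (systemA-row (s≤s z≤n))) (≡[mod]⇒≈ (system 1 ℕP.≤-refl (s≤s z≤n))))))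
    all-rows : D q ≈ 0ℤ → SystemA p
    all-rows D≈0 (suc k) _ k<q = ≈⇒≡[mod] (begin
      Σℤ q (λ j → matA p (suc k) (suc j) * + bell j)  ≈⟨ systemA-row k<q ⟩
      D k - D q                                        ≈⟨ +-cong (≈-refl {D k}) (neg-cong D≈0) ⟩
      D k - 0ℤ                                         ≡⟨ ℤP.+-identityʳ (D k) ⟩
      D k                                              ∎)

  -- Rows of the second system read B_n + 0ⁿ·D_q ≡ B_n; the first row forces D_q ≡ 0.
  systemC⇔D≈0 : SystemC p ⇔ (signedDerangement q ≈ 0ℤ)
  systemC⇔D≈0 = mk⇔ from-first-row all-rows
    where
    D = signedDerangement
    from-first-row : SystemC p → D q ≈ 0ℤ
    from-first-row system = ≈-trans (≡⇒≈ (sym (ℤP.*-identityˡ (D q)))) (+-absorbs⇒≈0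
      (≈-trans (≈-sym (systemC-row z≤n)) (≡[mod]⇒≈ (system 1 ℕP.≤-refl (s≤s z≤n)))))
    all-rows : D q ≈ 0ℤ → SystemC p
    all-rows D≈0 (suc n) _ n<q = ≈⇒≡[mod] (begin
      Σℤ q (λ j → matC p (suc n) (suc j) * (sgn (suc j) * derangement j))
        ≈⟨ systemC-row (ℕP.<⇒≤ n<q) ⟩
      + bell n + + (0 ℕ.^ n) * D q
        ≈⟨ +-cong (≈-refl {+ bell n}) (*-cong (≈-refl {+ (0 ℕ.^ n)}) D≈0) ⟩
      + bell n + + (0 ℕ.^ n) * 0ℤ
        ≡⟨ trans (cong (_+_ (+ bell n)) (ℤP.*-zeroʳ (+ (0 ℕ.^ n)))) (ℤP.+-identityʳ (+ bell n)) ⟩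
      + bell n ∎)

-- Proposition 5: for a prime p, each system holds in 𝔽_p exactly when p divides !p, because all
-- three conditions are equivalent to D_{p−1} ≡ 0 (mod p).  (The proof does not need p odd.)
proposition5 : (p : ℕ) → Prime p → p ≢ 2 →
    ((p ∣ leftFactorial p) ⇔ SystemA p) × ((p ∣ leftFactorial p) ⇔ SystemC p)
proposition5 zero          p-prime _ = ⊥-elim (¬prime[0] p-prime)
proposition5 (suc zero)    p-prime _ = ⊥-elim (¬prime[1] p-prime)
proposition5 (suc (suc r)) p-prime _ =
  ⇔.trans kurepa⇔D≈0 (⇔.sym systemA⇔D≈0) , ⇔.trans kurepa⇔D≈0 (⇔.sym systemC⇔D≈0)
  where open PrimeModulus r p-prime
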